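{- Let $0<q<n$ be integers, $S\in\Sigma^n$ and $C\in\Sigma^q$. Let $S_1=S[i\,..\,j]$ and $S_2=S[i'\,..\,j']$ be fragments of $S$ with $i\le i'$ and $j\le j'$ such that (1) they share at least $2q$ positions of $S$ (i.e. $j-i'+1\ge 2q$) and (2) $C$ is a seed of both $S_1$ and $S_2$. Then $C$ is a seed of $S_3=S[i\,..\,j']$.
   Context: $S[i\,..\,j]$ denotes the fragment $S[i]S[i+1]\cdots S[j]$ of $S$. A string $C$ is a cover of a string $T$ if $|C|<|T|$ and every position $k$ of $T$ lies in an occurrence of $C$ in $T$, i.e. $C$ occurs in $T$ starting at some position in $\{\max(k-|C|+1,1),\dots,k\}$. A string $C$ is a seed of $T$ if $|C|\le|T|$ and $C$ is a cover of some string containing $T$ as a substring. -}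

module Defs where

open import Data.Nat using (ℕ; suc; _+_; _∸_; _≤_; _<_)
open import Data.List using (List; length; _++_; take; drop)
open import Data.Product using (Σ; ∃; ∃₂; _×_)
open import Relation.Binary.PropositionalEquality using (_≡_)

-- Strings over an alphabet A are lists; positions in definitions below are 0-based.

OccursAt : {A : Set} → List A → List A → ℕ → Set
OccursAt {A} C T s = ∃₂ λ (u v : List A) → T ≡ u ++ C ++ v × length u ≡ s

Cover : {A : Set} → List A → List A → Set
Cover C T = length C < length T ×
  (∀ k → k < length T → ∃ λ s → s ≤ k × k < s + length C × OccursAt C T s)

Substring : {A : Set} → List A → List A → Set
Substring {A} T U = ∃₂ λ (u v : List A) → U ≡ u ++ T ++ v

Seed : {A : Set} → List A → List A → Set
Seed {A} C T = length C ≤ length T × ∃ λ (U : List A) → Substring T U × Cover C U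

-- Fragment S[i..j] with 1-based inclusive positions i ≤ j (as in the paper).
frag : {A : Set} → List A → ℕ → ℕ → List A
frag S i j = take (suc j ∸ i) (drop (i ∸ 1) S)

{-# OPTIONS --safe #-}
-- If C covers U₁ = u₁ S₁ v₁ and U₂ = u₂ S₂ v₂, then C covers u₁ S₃ v₂.  A position
-- whose C-window ends inside u₁ S₁ is covered by an occurrence taken from U₁.  Any
-- other position lies at least |C| positions past the start of S₂, since S₁ and S₂
-- share at least 2|C| positions; so every occurrence in U₂ covering it lies inside
-- S₂ v₂, and it is also an occurrence in u₁ S₃ v₂.
module Submission where

open import Defs
open import Data.Nat using (ℕ; zero; suc; _+_; _∸_; _*_; _≤_; _<_; z≤n; s≤s; _≤?_)
open import Data.Nat.Properties
open import Data.List using (List; []; _∷_; length; _++_; take; drop)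
open import Data.List.Properties
  using (++-assoc; ∷-injective; length-++; length-take; length-drop; drop-drop; take-[])
open import Data.Product using (∃; _×_; _,_)
open import Relation.Binary.PropositionalEquality
  using (_≡_; refl; sym; trans; cong; cong₂; subst; module ≡-Reasoning)
open import Relation.Nullary using (yes; no)

private variable
  A : Set

++-split : (as xs ys bs : List A) → xs ++ ys ≡ as ++ bs → length as ≤ length xs →
           ∃ λ w → xs ≡ as ++ w × bs ≡ w ++ ys
++-split []       xs       ys bs eq _         = xs , refl , sym eq
++-split (a ∷ as) (x ∷ xs) ys bs eq (s≤s as≤xs)
  with x≡a , eq′ ← ∷-injective eq
  with w , xs≡as++w , bs≡w++ys ← ++-split as xs ys bs eq′ as≤xs
  = w , cong₂ _∷_ x≡a xs≡as++w , bs≡w++ys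

take-+ : (m k : ℕ) (xs : List A) → take (m + k) xs ≡ take m xs ++ take k (drop m xs)
take-+ zero    k xs       = refl
take-+ (suc m) k []       = sym (take-[] k)
take-+ (suc m) k (x ∷ xs) = cong (x ∷_) (take-+ m k xs)

occursAt-++⁺ˡ : {C P : List A} {s : ℕ} (Q : List A) → OccursAt C P s → OccursAt C (P ++ Q) s
occursAt-++⁺ˡ {C = C} Q (u , v , refl , |u|≡s) =
  u , v ++ Q , trans (++-assoc u (C ++ v) Q) (cong (u ++_) (++-assoc C v Q)) , |u|≡s

occursAt-++⁺ʳ : {C R : List A} {e : ℕ} (Z : List A) →
                OccursAt C R e → OccursAt C (Z ++ R) (length Z + e)
occursAt-++⁺ʳ {C = C} Z (u , v , refl , refl) = Z ++ u , v , sym (++-assoc Z u (C ++ v)) , length-++ Z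

occursAt-++⁻ˡ : {C Q : List A} {s : ℕ} (P : List A) →
                OccursAt C (P ++ Q) s → s + length C ≤ length P → OccursAt C P s
occursAt-++⁻ˡ {C = C} {Q} P (u , v , eq , refl) end≤|P|
  with w , P≡u++C++w , _ ← ++-split (u ++ C) P Q v (trans eq (sym (++-assoc u C v)))
                                    (subst (_≤ length P) (sym (length-++ u)) end≤|P|)
  = u , w , trans P≡u++C++w (++-assoc u C w) , refl

occursAt-++⁻ʳ : {C R : List A} {e : ℕ} (Y : List A) →
                OccursAt C (Y ++ R) (length Y + e) → OccursAt C R e
occursAt-++⁻ʳ {C = C} {R} {e} Y (u , v , eq , |u|≡|Y|+e)
  with w , u≡Y++w , R≡w++C++v ← ++-split Y u (C ++ v) R (sym eq)
                                         (subst (length Y ≤_) (sym |u|≡|Y|+e) (m≤m+n (length Y) e))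
  = w , v , R≡w++C++v ,
    +-cancelˡ-≡ (length Y) _ _ (trans (sym (length-++ Y)) (trans (cong length (sym u≡Y++w)) |u|≡|Y|+e))

CoveredAt : List A → List A → ℕ → Set
CoveredAt C T k = ∃ λ s → s ≤ k × k < s + length C × OccursAt C T s

covered-++ˡ : {C Q Q′ : List A} {k : ℕ} (P : List A) →
              CoveredAt C (P ++ Q) k → k + length C ≤ length P → CoveredAt C (P ++ Q′) k
covered-++ˡ {C = C} {Q′ = Q′} P (s , s≤k , k<s+|C| , occ) k+|C|≤|P| =
  s , s≤k , k<s+|C| ,
  occursAt-++⁺ˡ Q′ (occursAt-++⁻ˡ P occ (≤-trans (+-monoˡ-≤ (length C) s≤k) k+|C|≤|P|))

p≤1+n⇒m+n<o+p⇒m≤o : ∀ {m n o p} → p ≤ suc n → m + n < o + p → m ≤ o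
p≤1+n⇒m+n<o+p⇒m≤o {m} {n} {o} {p} p≤1+n m+n<o+p = +-cancelʳ-≤ p m o (begin
  m + p        ≤⟨ +-monoʳ-≤ m p≤1+n ⟩
  m + suc n    ≡⟨ +-suc m n ⟩
  suc (m + n)  ≤⟨ m+n<o+p ⟩
  o + p        ∎)
  where open ≤-Reasoning

-- The bound on |C| forces every occurrence covering the position to start inside R.
covered-++ʳ : {C R : List A} {e : ℕ} (Y Z : List A) →
              CoveredAt C (Y ++ R) (length Y + e) → length C ≤ suc e →
              CoveredAt C (Z ++ R) (length Z + e)
covered-++ʳ {C = C} {e = e} Y Z (s , s≤|Y|+e , |Y|+e<s+|C| , occ) |C|≤1+e
  with d , refl ← m≤n⇒∃[o]m+o≡n (p≤1+n⇒m+n<o+p⇒m≤o |C|≤1+e |Y|+e<s+|C|)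
  = length Z + d , +-monoʳ-≤ (length Z) (+-cancelˡ-≤ (length Y) d e s≤|Y|+e) ,
    shift |Y|+e<s+|C| , occursAt-++⁺ʳ Z (occursAt-++⁻ʳ Y occ)
  where
  shift : ∀ {d} → length Y + e < length Y + d + length C → length Z + e < length Z + d + length C
  shift {d} lt =
    subst (length Z + e <_) (sym (+-assoc (length Z) d (length C)))
      (+-monoʳ-< (length Z) (+-cancelˡ-< (length Y) e (d + length C)
        (subst (length Y + e <_) (+-assoc (length Y) d (length C)) lt)))

cover-nonempty : {C T : List A} → Cover C T → 0 < length C
cover-nonempty (|C|<|T| , covered) with covered 0 (≤-<-trans z≤n |C|<|T|)
... | _ , z≤n , 0<|C| , _ = 0<|C|

cover-glue : {C P Q Q₁ Y Z R U : List A} →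
             U ≡ P ++ Q → U ≡ Z ++ R → length Z + 2 * length C ≤ length P →
             Cover C (P ++ Q₁) → Cover C (Y ++ R) → Cover C U
cover-glue {C = C} {P} {Q} {Q₁} {Y} {Z} {R} {U} U≡P++Q U≡Z++R |Z|+2c≤|P|
           cover₁@(_ , covered₁) (_ , covered₂) = |C|<|U| , covered
  where
  open ≤-Reasoning
  c = length C

  0<c : 0 < c
  0<c = cover-nonempty cover₁

  |Z|+c+c≤|P| : length Z + c + c ≤ length P
  |Z|+c+c≤|P| = begin
    length Z + c + c    ≡⟨ +-assoc (length Z) c c ⟩
    length Z + (c + c)  ≡⟨ cong (λ t → length Z + (c + t)) (sym (+-identityʳ c)) ⟩
    length Z + 2 * c    ≤⟨ |Z|+2c≤|P| ⟩
    length P            ∎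

  |P|≤|U| : length P ≤ length U
  |P|≤|U| = subst (length P ≤_) (sym (trans (cong length U≡P++Q) (length-++ P)))
                  (m≤m+n (length P) (length Q))

  |C|<|U| : c < length U
  |C|<|U| = begin-strict
    c                 ≤⟨ m≤n+m c (length Z) ⟩
    length Z + c      <⟨ m<m+n (length Z + c) 0<c ⟩
    length Z + c + c  ≤⟨ |Z|+c+c≤|P| ⟩
    length P          ≤⟨ |P|≤|U| ⟩
    length U          ∎

  covered-in-P : ∀ k → k + c ≤ length P → CoveredAt C U k
  covered-in-P k k+c≤|P| =
    subst (λ T → CoveredAt C T k) (sym U≡P++Q) (covered-++ˡ P (covered₁ k k<|P++Q₁|) k+c≤|P|)
    where
    k<|P++Q₁| : k < length (P ++ Q₁)
    k<|P++Q₁| = begin-strict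
      k                     <⟨ m<m+n k 0<c ⟩
      k + c                 ≤⟨ k+c≤|P| ⟩
      length P              ≤⟨ m≤m+n (length P) (length Q₁) ⟩
      length P + length Q₁  ≡⟨ length-++ P ⟨
      length (P ++ Q₁)      ∎

  covered-in-R : ∀ e → c < e → length Z + e < length U → CoveredAt C U (length Z + e)
  covered-in-R e c<e |Z|+e<|U| =
    subst (λ T → CoveredAt C T (length Z + e)) (sym U≡Z++R)
      (covered-++ʳ Y Z (covered₂ (length Y + e) |Y|+e<|Y++R|) (m<n⇒m≤1+n c<e))
    where
    e<|R| : e < length R
    e<|R| = +-cancelˡ-< (length Z) e (length R)
              (subst (length Z + e <_) (trans (cong length U≡Z++R) (length-++ Z)) |Z|+e<|U|)
    |Y|+e<|Y++R| : length Y + e < length (Y ++ R)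
    |Y|+e<|Y++R| = subst (length Y + e <_) (sym (length-++ Y)) (+-monoʳ-< (length Y) e<|R|)

  past-P : ∀ k → length P < k + c → length Z + c < k
  past-P k |P|<k+c = +-cancelʳ-< c (length Z + c) k (≤-<-trans |Z|+c+c≤|P| |P|<k+c)

  covered : ∀ k → k < length U → CoveredAt C U k
  covered k k<|U| with k + c ≤? length P
  ... | yes k+c≤|P| = covered-in-P k k+c≤|P|
  ... | no  k+c≰|P|
    with e , refl ← m≤n⇒∃[o]m+o≡n (≤-trans (m≤m+n (length Z) c) (<⇒≤ (past-P k (≰⇒> k+c≰|P|))))
    = covered-in-R e (+-cancelˡ-< (length Z) c e (past-P _ (≰⇒> k+c≰|P|))) k<|U|

seed-glue : {C S₁ S₂ S₃ X W : List A} →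
            S₃ ≡ S₁ ++ W → S₃ ≡ X ++ S₂ → length X + 2 * length C ≤ length S₁ →
            Seed C S₁ → Seed C S₂ → Seed C S₃
seed-glue {C = C} {S₁} {S₂} {_} {X} {W} refl S₁++W≡X++S₂ |X|+2c≤|S₁|
          (_ , _ , (u₁ , v₁ , refl) , cover₁) (_ , _ , (u₂ , v₂ , refl) , cover₂) =
  |C|≤|S₁++W| , u₁ ++ (S₁ ++ W) ++ v₂ , (u₁ , v₂ , refl) ,
  cover-glue {P = u₁ ++ S₁} {Y = u₂} {Z = u₁ ++ X} U≡P++Q U≡Z++R |Z|+2c≤|P|
             (subst (Cover C) (sym (++-assoc u₁ S₁ v₁)) cover₁) cover₂
  where
  c = length C

  U≡P++Q : u₁ ++ (S₁ ++ W) ++ v₂ ≡ (u₁ ++ S₁) ++ W ++ v₂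
  U≡P++Q = trans (cong (u₁ ++_) (++-assoc S₁ W v₂)) (sym (++-assoc u₁ S₁ (W ++ v₂)))

  U≡Z++R : u₁ ++ (S₁ ++ W) ++ v₂ ≡ (u₁ ++ X) ++ S₂ ++ v₂
  U≡Z++R = begin
    u₁ ++ (S₁ ++ W) ++ v₂  ≡⟨ cong (λ T → u₁ ++ T ++ v₂) S₁++W≡X++S₂ ⟩
    u₁ ++ (X ++ S₂) ++ v₂  ≡⟨ cong (u₁ ++_) (++-assoc X S₂ v₂) ⟩
    u₁ ++ X ++ S₂ ++ v₂    ≡⟨ ++-assoc u₁ X (S₂ ++ v₂) ⟨
    (u₁ ++ X) ++ S₂ ++ v₂  ∎
    where open ≡-Reasoning

  |Z|+2c≤|P| : length (u₁ ++ X) + 2 * c ≤ length (u₁ ++ S₁)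
  |Z|+2c≤|P| = begin
    length (u₁ ++ X) + 2 * c       ≡⟨ cong (_+ 2 * c) (length-++ u₁) ⟩
    length u₁ + length X + 2 * c   ≡⟨ +-assoc (length u₁) (length X) (2 * c) ⟩
    length u₁ + (length X + 2 * c) ≤⟨ +-monoʳ-≤ (length u₁) |X|+2c≤|S₁| ⟩
    length u₁ + length S₁          ≡⟨ length-++ u₁ ⟨
    length (u₁ ++ S₁)              ∎
    where open ≤-Reasoning

  |C|≤|S₁++W| : c ≤ length (S₁ ++ W)
  |C|≤|S₁++W| = begin
    c                       ≤⟨ m≤m+n c _ ⟩
    2 * c                   ≤⟨ m≤n+m (2 * c) (length X) ⟩
    length X + 2 * c        ≤⟨ |X|+2c≤|S₁| ⟩
    length S₁               ≤⟨ m≤m+n (length S₁) (length W) ⟩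
    length S₁ + length W    ≡⟨ length-++ S₁ ⟨
    length (S₁ ++ W)        ∎
    where open ≤-Reasoning

frag-extendʳ : (S : List A) (i : ℕ) {j j′ : ℕ} → j ≤ j′ → ∃ λ W → frag S i j′ ≡ frag S i j ++ W
frag-extendʳ S i {j} {j′} j≤j′ =
  _ , trans (cong (λ m → take m T) (sym (m+[n∸m]≡n (∸-monoˡ-≤ i (s≤s j≤j′)))))
            (take-+ (suc j ∸ i) _ T)
  where
  T = drop (i ∸ 1) S

frag-split : (S : List A) {a b j : ℕ} → a ≤ b → b ≤ j →
             frag S (suc a) j ≡ frag S (suc a) b ++ frag S (suc b) j
frag-split S {a} {b} {j} a≤b b≤j = begin
  take (j ∸ a) (drop a S)
    ≡⟨ cong (λ m → take m (drop a S)) j∸a≡[b∸a]+[j∸b] ⟩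
  take (b ∸ a + (j ∸ b)) (drop a S)
    ≡⟨ take-+ (b ∸ a) (j ∸ b) (drop a S) ⟩
  take (b ∸ a) (drop a S) ++ take (j ∸ b) (drop (b ∸ a) (drop a S))
    ≡⟨ cong (λ T → take (b ∸ a) (drop a S) ++ take (j ∸ b) T) drop-b∸a-from-a ⟩
  take (b ∸ a) (drop a S) ++ take (j ∸ b) (drop b S)
    ∎
  where
  open ≡-Reasoning
  j∸a≡[b∸a]+[j∸b] : j ∸ a ≡ b ∸ a + (j ∸ b)
  j∸a≡[b∸a]+[j∸b] = begin
    j ∸ a              ≡⟨ cong (_∸ a) (m∸n+n≡m b≤j) ⟨
    j ∸ b + b ∸ a      ≡⟨ +-∸-assoc (j ∸ b) a≤b ⟩
    j ∸ b + (b ∸ a)    ≡⟨ +-comm (j ∸ b) (b ∸ a) ⟩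
    b ∸ a + (j ∸ b)    ∎
  drop-b∸a-from-a : drop (b ∸ a) (drop a S) ≡ drop b S
  drop-b∸a-from-a = trans (drop-drop a (b ∸ a) S) (cong (λ m → drop m S) (m+[n∸m]≡n a≤b))

length-frag : (S : List A) (a : ℕ) {j : ℕ} → j ≤ length S → length (frag S (suc a) j) ≡ j ∸ a
length-frag S a {j} j≤|S| =
  trans (length-take (j ∸ a) (drop a S))
        (m≤n⇒m⊓n≡m (subst (j ∸ a ≤_) (sym (length-drop a S)) (∸-monoˡ-≤ a j≤|S|)))

mainTheorem4 : {Σ : Set} (q n : ℕ) (S C : List Σ) (i j i′ j′ : ℕ) →
    0 < q → q < n → length S ≡ n → length C ≡ q →
    1 ≤ i → i ≤ i′ → j ≤ j′ → j′ ≤ n →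
    2 * q + i′ ≤ suc j →
    Seed C (frag S i j) → Seed C (frag S i′ j′) →
    Seed C (frag S i j′)
mainTheorem4 q n S C (suc a) j (suc a′) j′ _ _ refl refl _ (s≤s a≤a′) j≤j′ j′≤n 2q+1+a′≤1+j seed₁ seed₂
  with W , S₃≡S₁++W ← frag-extendʳ S (suc a) j≤j′
  = seed-glue S₃≡S₁++W (frag-split S a≤a′ (≤-trans a′≤j j≤j′)) |X|+2q≤|S₁| seed₁ seed₂
  where
  open ≤-Reasoning
  a′+2q≤j : a′ + 2 * q ≤ j
  a′+2q≤j = ≤-pred (begin
    suc (a′ + 2 * q)  ≡⟨ cong suc (+-comm a′ (2 * q)) ⟩
    suc (2 * q + a′)  ≡⟨ +-suc (2 * q) a′ ⟨
    2 * q + suc a′    ≤⟨ 2q+1+a′≤1+j ⟩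
    suc j             ∎)
  a′≤j : a′ ≤ j
  a′≤j = ≤-trans (m≤m+n a′ (2 * q)) a′+2q≤j
  j≤n : j ≤ n
  j≤n = ≤-trans j≤j′ j′≤n
  |X|+2q≤|S₁| : length (frag S (suc a) a′) + 2 * q ≤ length (frag S (suc a) j)
  |X|+2q≤|S₁| = begin
    length (frag S (suc a) a′) + 2 * q  ≡⟨ cong (_+ 2 * q) (length-frag S a (≤-trans a′≤j j≤n)) ⟩
    a′ ∸ a + 2 * q                      ≡⟨ +-∸-comm (2 * q) a≤a′ ⟨
    a′ + 2 * q ∸ a                      ≤⟨ ∸-monoˡ-≤ a a′+2q≤j ⟩
    j ∸ a                               ≡⟨ length-frag S a j≤n ⟨
    length (frag S (suc a) j)           ∎
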